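{- Let $(S,\le,\prec)$ be a proximity poset. (1) The lower powerlocale $\mathrm{P_L}(S)$ is a strong proximity $\vee$-semilattice (with $0=\emptyset$ and $A\vee B=A\cup B$). (2) The relation $\varepsilon^L_S\subseteq\mathrm{Fin}(S)\times S$ defined by $A\,\varepsilon^L_S\,a\iff A\prec_L\{a\}$ is an approximable relation from $\mathrm{P_L}(S)$ to $(S,\prec)$ with the following universal property: for any strong proximity $\vee$-semilattice $(S',0',\vee',\prec')$ and any approximable relation $r:S'\to S$, there exists a unique join-approximable relation $\overline r:S'\to\mathrm{P_L}(S)$ such that $\varepsilon^L_S\circ\overline r=r$.
   Context: Work constructively; $\mathrm{Fin}(S)$ is the set of finitely enumerable subsets of $S$. A proximity poset is $(S,\le,\prec)$ with $(S,\le)$ a poset and $\prec$ a relation such that for every $a$: $\{b\mid b\prec a\}$ is a rounded ideal (a downward closed, inhabited, upward directed $I$ with $x\in I\iff\exists y\,(x\prec y\ \&\ y\in I)$) and $\{b\mid a\prec b\}$ is a rounded upward closed set ($x\in U\iff\exists y\,(y\prec x\ \&\ y\in U)$). An approximable relation $(S,\prec)\to(S',\prec')$ is $r\subseteq S\times S'$ with $\{a\mid a\,r\,b\}$ a rounded ideal for each $b$ and $\{b\mid a\,r\,b\}$ a rounded upward closed set for each $a$; composition $s\circ r$ is relational composition (first $r$ then $s$). A proximity $\vee$-semilattice is a proximity poset whose poset is a join-semilattice $(S,0,\vee)$; it is strong if $a\prec0\Rightarrow a=0$ and $a\prec b\vee c\Rightarrow\exists b',c'\,(a\le b'\vee c'\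 \&\ b'\prec b\ \&\ c'\prec c)$. An approximable relation $r$ between proximity $\vee$-semilattices $S\to S''$ is join-approximable if $a\,r\,0''\Rightarrow a=0$ and $a\,r\,(b\vee''c)\Rightarrow\exists b',c'\,(a\le b'\vee c'\ \&\ b'\,r\,b\ \&\ c'\,r\,c)$. For a relation $r\subseteq X\times Y$, $A\,r_L\,B\iff\forall a\in A\,\exists b\in B\,(a\,r\,b)$ for $A\in\mathrm{Fin}(X),B\in\mathrm{Fin}(Y)$. The lower powerlocale of $(S,\le,\prec)$ is $\mathrm{P_L}(S)=((\mathrm{Fin}(S),\le_L),\prec_L)$, where $(\mathrm{Fin}(S),\le_L)$ is the poset reflection of the preorder $\le_L$. -}

module Defs where

open import Level using (Level) renaming (suc to lsuc)
open import Data.Product using (Σ; ∃; ∃₂; _×_; _,_)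
open import Data.List using (List; []; [_]; _++_)
open import Data.List.Relation.Unary.All using (All)
open import Data.List.Relation.Unary.Any using (Any)
open import Relation.Binary.Core using (Rel; REL)
open import Relation.Binary.Bundles using (Poset)
open import Relation.Binary.Lattice.Bundles using (BoundedJoinSemilattice)
open import Relation.Binary.Lattice.Structures using (IsBoundedJoinSemilattice)
open import Relation.Unary using (Pred)
open import Function.Bundles using (_⇔_)

module _ {ℓ : Level} {S : Set ℓ} (_≤_ : Rel S ℓ) (_≺_ : Rel S ℓ) where

  IsRoundedIdeal : Pred S ℓ → Set ℓ
  IsRoundedIdeal I =
      (∀ {x y} → x ≤ y → I y → I x)
    × (∃ λ x → I x)
    × (∀ {x y} → I x → I y → ∃ λ z → I z × x ≤ z × y ≤ z)
    × (∀ x → I x ⇔ (∃ λ y → x ≺ y × I y))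

  IsRoundedUpper : Pred S ℓ → Set ℓ
  IsRoundedUpper U =
      (∀ {x y} → x ≤ y → U x → U y)
    × (∀ x → U x ⇔ (∃ λ y → y ≺ x × U y))

  IsProximity : Set ℓ
  IsProximity = ∀ a → IsRoundedIdeal (λ b → b ≺ a) × IsRoundedUpper (λ b → a ≺ b)

IsApproximable : {ℓ : Level} {S T : Set ℓ}
  (_≤₁_ _≺₁_ : Rel S ℓ) (_≤₂_ _≺₂_ : Rel T ℓ) → REL S T ℓ → Set ℓ
IsApproximable _≤₁_ _≺₁_ _≤₂_ _≺₂_ r =
    (∀ b → IsRoundedIdeal _≤₁_ _≺₁_ (λ a → r a b))
  × (∀ a → IsRoundedUpper _≤₂_ _≺₂_ (λ b → r a b))

IsStrong : {ℓ : Level} {S : Set ℓ}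
  (_≈_ _≤_ _≺_ : Rel S ℓ) (_∨_ : S → S → S) (0S : S) → Set ℓ
IsStrong _≈_ _≤_ _≺_ _∨_ 0S =
    (∀ a → a ≺ 0S → a ≈ 0S)
  × (∀ a b c → a ≺ (b ∨ c) →
       ∃₂ λ b' c' → a ≤ (b' ∨ c') × b' ≺ b × c' ≺ c)

IsJoinApproximable : {ℓ : Level} {S T : Set ℓ}
  (_≈₁_ _≤₁_ _≺₁_ : Rel S ℓ) (_∨₁_ : S → S → S) (0₁ : S)
  (_≤₂_ _≺₂_ : Rel T ℓ) (_∨₂_ : T → T → T) (0₂ : T) → REL S T ℓ → Set ℓ
IsJoinApproximable _≈₁_ _≤₁_ _≺₁_ _∨₁_ 0₁ _≤₂_ _≺₂_ _∨₂_ 0₂ r =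
    IsApproximable _≤₁_ _≺₁_ _≤₂_ _≺₂_ r
  × (∀ a → r a 0₂ → a ≈₁ 0₁)
  × (∀ a b c → r a (b ∨₂ c) →
       ∃₂ λ b' c' → a ≤₁ (b' ∨₁ c') × r b' b × r c' c)

_∘ᴿ_ : {ℓ : Level} {A B C : Set ℓ} → REL B C ℓ → REL A B ℓ → REL A C ℓ
(s ∘ᴿ r) a c = ∃ λ b → r a b × s b c

_≐ᴿ_ : {ℓ : Level} {A B : Set ℓ} → REL A B ℓ → REL A B ℓ → Set ℓ
r ≐ᴿ s = ∀ a b → r a b ⇔ s a b

record ProximityPoset (ℓ : Level) : Set (lsuc ℓ) where
  field
    poset : Poset ℓ ℓ ℓ
  open Poset poset public
  field
    _≺_         : Rel Carrier ℓ
    isProximity : IsProximity _≤_ _≺_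

record ProximityJoinSemilattice (ℓ : Level) : Set (lsuc ℓ) where
  field
    semilattice : BoundedJoinSemilattice ℓ ℓ ℓ
  open BoundedJoinSemilattice semilattice public
  field
    _≺_         : Rel Carrier ℓ
    isProximity : IsProximity _≤_ _≺_

  IsStrongPJS : Set ℓ
  IsStrongPJS = IsStrong _≈_ _≤_ _≺_ _∨_ ⊥

lowerᴸ : {ℓ : Level} {X Y : Set ℓ} → REL X Y ℓ → REL (List X) (List Y) ℓ
lowerᴸ r A B = All (λ a → Any (λ b → r a b) B) A

-- Fin(S) is
-- represented by lists; the poset reflection of the preorder ≤_L is
-- given by taking as equality the equivalence A ≈_L B := A ≤_L B × B ≤_L A.

module LowerPowerlocale {ℓ : Level} (S : ProximityPoset ℓ) where
  open ProximityPoset S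

  FinS : Set ℓ
  FinS = List Carrier

  _≤L_ : Rel FinS ℓ
  _≤L_ = lowerᴸ _≤_

  _≈L_ : Rel FinS ℓ
  A ≈L B = A ≤L B × B ≤L A

  _≺L_ : Rel FinS ℓ
  _≺L_ = lowerᴸ _≺_

  0L : FinS
  0L = []

  _∨L_ : FinS → FinS → FinS
  _∨L_ = _++_

  εL : REL FinS Carrier ℓ
  εL A a = A ≺L [ a ]

  IsStrongProximityJoinSemilatticeL : Set ℓ
  IsStrongProximityJoinSemilatticeL =
      IsBoundedJoinSemilattice _≈L_ _≤L_ _∨L_ 0L
    × IsProximity _≤L_ _≺L_
    × IsStrong _≈L_ _≤L_ _≺L_ _∨L_ 0L

  module _ (S' : ProximityJoinSemilattice ℓ) where
    private module S' = ProximityJoinSemilattice S'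

    IsJoinApproxIntoPL : REL S'.Carrier FinS ℓ → Set ℓ
    IsJoinApproxIntoPL = IsJoinApproximable S'._≈_ S'._≤_ S'._≺_ S'._∨_ S'.⊥
                                            _≤L_ _≺L_ _∨L_ 0L

    UniqueLift : REL S'.Carrier Carrier ℓ → Set (lsuc ℓ)
    UniqueLift r =
      Σ (REL S'.Carrier FinS ℓ) λ r̄ →
          IsJoinApproxIntoPL r̄
        × (εL ∘ᴿ r̄) ≐ᴿ r
        × ((s : REL S'.Carrier FinS ℓ) → IsJoinApproxIntoPL s → (εL ∘ᴿ s) ≐ᴿ r → s ≐ᴿ r̄)

  UniversalPropertyL : Set (lsuc ℓ)
  UniversalPropertyL =
    (S' : ProximityJoinSemilattice ℓ) → ProximityJoinSemilattice.IsStrongPJS S' →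
    (r : REL (ProximityJoinSemilattice.Carrier S') Carrier ℓ) →
    IsApproximable (ProximityJoinSemilattice._≤_ S') (ProximityJoinSemilattice._≺_ S') _≤_ _≺_ r →
    UniqueLift S' r

-- The lift is r̄ x A :⇔ x ≤ ⋁Y for some finite Y with Y r_L A.  Since A ≺_L {a} says that
-- A lies in the rounded ideal ↓a, and rounded ideals absorb finite joins, ε^L ∘ r̄ = r.
-- Strongness of S' splits x ≺' ⋁Y into pieces along Y, which makes r̄ rounded and
-- join-approximable.  Conversely a join-approximable s with ε^L ∘ s = r splits s x C along
-- the singletons of C, and each piece s y {c} is determined by r; hence s = r̄.
module Submission where

open import Defs
open import Level using (Level)
open import Data.Product using (_×_; _,_; proj₁; proj₂; ∃; ∃₂)
open import Data.Sum using (inj₁; inj₂)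
open import Data.List using (List; []; _∷_; [_]; _++_; foldr; map)
open import Data.List.Properties using (concat-map-[_])
open import Data.List.Membership.Propositional using (_∈_; find; lose)
open import Data.List.Membership.Propositional.Properties using (∈-insert)
open import Data.List.Relation.Binary.Subset.Propositional using (_⊆_)
open import Data.List.Relation.Binary.Subset.Propositional.Properties
  using (⊆-refl; ⊆-trans; xs⊆xs++ys; xs⊆ys++xs; xs⊆x∷xs; ∷⁺ʳ; ∈-∷⁺ʳ; ++⁺ʳ)
open import Data.List.Relation.Unary.All as All using (All; []; _∷_)
open import Data.List.Relation.Unary.Any as Any using (Any; here; there)
import Data.List.Relation.Unary.All.Properties as Allₚ
import Data.List.Relation.Unary.Any.Properties as Anyₚ
open import Relation.Binary.Core using (Rel; REL; _⇒_)
open import Relation.Binary.Definitions using (Reflexive; Transitive; Trans)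
import Relation.Binary.PropositionalEquality as ≡
open import Relation.Binary.Lattice.Bundles using (BoundedJoinSemilattice)
open import Relation.Binary.Lattice.Structures using (IsBoundedJoinSemilattice)
import Relation.Binary.Lattice.Properties.JoinSemilattice as JoinSemilatticeProperties
open import Function.Bundles using (_⇔_; mk⇔; Equivalence)

private
  variable
    ℓ : Level
    X Y Z : Set ℓ

lowerᴸ-⊆ : {R : Rel X ℓ} → Reflexive R → ∀ {A B} → A ⊆ B → lowerᴸ R A B
lowerᴸ-⊆ R-refl A⊆B = All.tabulate (λ a∈A → lose (A⊆B a∈A) R-refl)

lowerᴸ-singletonʳ⁺ : {R : REL X Y ℓ} {A : List X} {b : Y} →
  All (λ a → R a b) A → lowerᴸ R A [ b ]
lowerᴸ-singletonʳ⁺ = All.map here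

lowerᴸ-singletonʳ⁻ : {R : REL X Y ℓ} {A : List X} {b : Y} →
  lowerᴸ R A [ b ] → All (λ a → R a b) A
lowerᴸ-singletonʳ⁻ = All.map Anyₚ.singleton⁻

lowerᴸ-trans : {P : REL X Y ℓ} {Q : REL Y Z ℓ} {R : REL X Z ℓ} →
  Trans P Q R → Trans (lowerᴸ P) (lowerᴸ Q) (lowerᴸ R)
lowerᴸ-trans {P = P} {R = R} trans {A} {B} {C} A≤B B≤C = All.map step A≤B
  where
  step : ∀ {a} → Any (P a) B → Any (R a) C
  step Pa = let (b , b∈B , Pab) = find Pa in Any.map (trans Pab) (All.lookup B≤C b∈B)

lowerᴸ-interpolate : {R : REL X Z ℓ} {P : REL X Y ℓ} {Q : REL Y Z ℓ} →
  R ⇒ (Q ∘ᴿ P) → lowerᴸ R ⇒ (lowerᴸ Q ∘ᴿ lowerᴸ P)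
lowerᴸ-interpolate interpolate [] = [] , [] , []
lowerᴸ-interpolate interpolate (Ra ∷ RAB) =
  let (b , b∈B , Rab) = find Ra
      (c , Pac , Qcb) = interpolate Rab
      (C , PAC , QCB) = lowerᴸ-interpolate interpolate RAB
  in c ∷ C , here Pac ∷ All.map there PAC , lose b∈B Qcb ∷ QCB

lowerᴸ-++-split : {R : REL X Y ℓ} (A : List X) {B C : List Y} → lowerᴸ R A (B ++ C) →
  ∃₂ λ A₁ A₂ → A ⊆ A₁ ++ A₂ × lowerᴸ R A₁ B × lowerᴸ R A₂ C
lowerᴸ-++-split [] [] = [] , [] , (λ ()) , [] , []
lowerᴸ-++-split (a ∷ A) {B} (Ra ∷ RA) with lowerᴸ-++-split A RA | Anyₚ.++⁻ B Ra
... | A₁ , A₂ , A⊆ , RA₁ , RA₂ | inj₁ RaB =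
  a ∷ A₁ , A₂ , ∷⁺ʳ a A⊆ , RaB ∷ RA₁ , RA₂
... | A₁ , A₂ , A⊆ , RA₁ , RA₂ | inj₂ RaC =
  A₁ , a ∷ A₂ , ∈-∷⁺ʳ (∈-insert A₁) (⊆-trans A⊆ (++⁺ʳ A₁ (xs⊆x∷xs A₂ a))) , RA₁ , RaC ∷ RA₂

module Approximable {_≤₁_ _≺₁_ : Rel X ℓ} {_≤₂_ _≺₂_ : Rel Y ℓ} {r : REL X Y ℓ}
  (approximable : IsApproximable _≤₁_ _≺₁_ _≤₂_ _≺₂_ r) where

  ideal : ∀ b → IsRoundedIdeal _≤₁_ _≺₁_ (λ a → r a b)
  ideal = proj₁ approximable

  private
    ideal-rounded : ∀ a b → r a b ⇔ (∃ λ a' → a ≺₁ a' × r a' b)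
    ideal-rounded a b = proj₂ (proj₂ (proj₂ (ideal b))) a

    upper-rounded : ∀ a b → r a b ⇔ (∃ λ b' → b' ≺₂ b × r a b')
    upper-rounded a b = proj₂ (proj₂ approximable a) b

  ≤-r-trans : Trans _≤₁_ r r
  ≤-r-trans = proj₁ (ideal _)

  r-≤-trans : Trans r _≤₂_ r
  r-≤-trans p q = proj₁ (proj₂ approximable _) q p

  ≺-r-trans : Trans _≺₁_ r r
  ≺-r-trans {a} {a'} {b} p q = Equivalence.from (ideal-rounded a b) (a' , p , q)

  r-≺-trans : Trans r _≺₂_ r
  r-≺-trans {a} {b} {b'} p q = Equivalence.from (upper-rounded a b') (b , q , p)

  r-interpolateˡ : r ⇒ (r ∘ᴿ _≺₁_)
  r-interpolateˡ {a} {b} = Equivalence.to (ideal-rounded a b)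

  r-interpolateʳ : r ⇒ (_≺₂_ ∘ᴿ r)
  r-interpolateʳ {a} {b} p =
    let (a' , a'≺b , raa') = Equivalence.to (upper-rounded a b) p in a' , raa' , a'≺b

proximity⇒approximable : {_≤_ _≺_ : Rel X ℓ} →
  IsProximity _≤_ _≺_ → IsApproximable _≤_ _≺_ _≤_ _≺_ _≺_
proximity⇒approximable prox = (λ a → proj₁ (prox a)) , (λ a → proj₂ (prox a))

module Proximity {_≤_ _≺_ : Rel X ℓ} (prox : IsProximity _≤_ _≺_) where
  open Approximable (proximity⇒approximable prox) public
    using ()
    renaming (ideal to ≺-ideal; ≤-r-trans to ≤-≺-trans; r-≤-trans to ≺-≤-trans; ≺-r-trans to ≺-trans;
              r-interpolateʳ to ≺-interpolate)

ideal-upperBound : {_≤_ _≺_ : Rel X ℓ} {I : X → Set ℓ} →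
  Transitive _≤_ → IsRoundedIdeal _≤_ _≺_ I → ∀ {Y} → All I Y → ∃ λ w → I w × All (_≤ w) Y
ideal-upperBound trans (_ , (w , Iw) , _ , _) [] = w , Iw , []
ideal-upperBound trans ideal@(_ , _ , directed , _) (Iy ∷ IY) =
  let (w , Iw , Y≤w) = ideal-upperBound trans ideal IY
      (z , Iz , y≤z , w≤z) = directed Iy Iw
  in z , Iz , y≤z ∷ All.map (λ y≤w → trans y≤w w≤z) Y≤w

module FiniteJoins {ℓ : Level} (L : BoundedJoinSemilattice ℓ ℓ ℓ) where
  open BoundedJoinSemilattice L
  open JoinSemilatticeProperties joinSemilattice using (∨-monotonic)

  ⋁ : List Carrier → Carrier
  ⋁ = foldr _∨_ ⊥

  ⋁-upperBound : ∀ {x Y} → x ∈ Y → x ≤ ⋁ Y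
  ⋁-upperBound {Y = y ∷ Y} (here ≡.refl) = x≤x∨y y (⋁ Y)
  ⋁-upperBound {Y = y ∷ Y} (there x∈Y) = trans (⋁-upperBound x∈Y) (y≤x∨y y (⋁ Y))

  ⋁-least : ∀ {z Y} → All (_≤ z) Y → ⋁ Y ≤ z
  ⋁-least [] = minimum _
  ⋁-least (y≤z ∷ Y≤z) = ∨-least y≤z (⋁-least Y≤z)

  ⋁-mono-⊆ : ∀ {Y Z} → Y ⊆ Z → ⋁ Y ≤ ⋁ Z
  ⋁-mono-⊆ Y⊆Z = ⋁-least (All.tabulate (λ y∈Y → ⋁-upperBound (Y⊆Z y∈Y)))

  ⋁-++ : ∀ Y Z → ⋁ (Y ++ Z) ≤ ⋁ Y ∨ ⋁ Z
  ⋁-++ Y Z = ⋁-least (All.tabulate bound)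
    where
    bound : ∀ {x} → x ∈ Y ++ Z → x ≤ ⋁ Y ∨ ⋁ Z
    bound x∈ with Anyₚ.++⁻ Y x∈
    ... | inj₁ x∈Y = trans (⋁-upperBound x∈Y) (x≤x∨y _ _)
    ... | inj₂ x∈Z = trans (⋁-upperBound x∈Z) (y≤x∨y _ _)

  ideal-⋁-closed : {_≺_ : Rel Carrier ℓ} {I : Carrier → Set ℓ} →
    IsRoundedIdeal _≤_ _≺_ I → ∀ {Y} → All I Y → I (⋁ Y)
  ideal-⋁-closed ideal@(downClosed , _) IY =
    let (w , Iw , Y≤w) = ideal-upperBound trans ideal IY in downClosed (⋁-least Y≤w) Iw

  ⋁-≺ : {_≺_ : Rel Carrier ℓ} → IsProximity _≤_ _≺_ → ∀ {Y Z} → lowerᴸ _≺_ Y Z → ⋁ Y ≺ ⋁ Z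
  ⋁-≺ {_≺_} prox Y≺Z = ideal-⋁-closed (≺-ideal _) (All.map below Y≺Z)
    where
    open Proximity prox
    below : ∀ {y Z} → Any (y ≺_) Z → y ≺ ⋁ Z
    below y≺Z = let (z , z∈Z , y≺z) = find y≺Z in ≺-≤-trans y≺z (⋁-upperBound z∈Z)

  split-⋁ : {T : Set ℓ} {_⊔_ : T → T → T} {ε : T} {R : REL Carrier T ℓ} →
    (∀ a → R a ε → a ≈ ⊥) →
    (∀ a b c → R a (b ⊔ c) → ∃₂ λ b' c' → a ≤ (b' ∨ c') × R b' b × R c' c) →
    ∀ {x} Y → R x (foldr _⊔_ ε Y) → ∃ λ Z → x ≤ ⋁ Z × lowerᴸ R Z Y
  split-⋁ R-zero R-join [] Rx = [] , reflexive (R-zero _ Rx) , []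
  split-⋁ R-zero R-join (y ∷ Y) Rx =
    let (b' , c' , x≤b'∨c' , Rb' , Rc') = R-join _ y _ Rx
        (Z , c'≤⋁Z , RZY) = split-⋁ R-zero R-join Y Rc'
    in b' ∷ Z , trans x≤b'∨c' (∨-monotonic refl c'≤⋁Z) , here Rb' ∷ All.map there RZY

module LowerPowerlocaleProperties {ℓ : Level} (S : ProximityPoset ℓ) where
  open ProximityPoset S
  open LowerPowerlocale S
  open Proximity isProximity

  ⊆⇒≤L : ∀ {A B} → A ⊆ B → A ≤L B
  ⊆⇒≤L = lowerᴸ-⊆ {R = _≤_} refl

  ≤L-refl : Reflexive _≤L_
  ≤L-refl = ⊆⇒≤L ⊆-refl

  ≤L-trans : Transitive _≤L_
  ≤L-trans = lowerᴸ-trans trans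

  ≺L-trans : Trans _≺L_ _≺L_ _≺L_
  ≺L-trans = lowerᴸ-trans ≺-trans

  ≺L-interpolate : _≺L_ ⇒ (_≺L_ ∘ᴿ _≺L_)
  ≺L-interpolate = lowerᴸ-interpolate ≺-interpolate

  isBoundedJoinSemilatticeL : IsBoundedJoinSemilattice _≈L_ _≤L_ _∨L_ 0L
  isBoundedJoinSemilatticeL = record
    { isJoinSemilattice = record
      { isPartialOrder = record
        { isPreorder = record
          { isEquivalence = record
            { refl  = ≤L-refl , ≤L-refl
            ; sym   = λ (A≤B , B≤A) → B≤A , A≤B
            ; trans = λ (A≤B , B≤A) (B≤C , C≤B) → ≤L-trans A≤B B≤C , ≤L-trans C≤B B≤A }
          ; reflexive = proj₁
          ; trans     = ≤L-trans }
        ; antisym = _,_ }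
      ; supremum = λ A B → ⊆⇒≤L (xs⊆xs++ys A B) , ⊆⇒≤L (xs⊆ys++xs B A)
                         , λ _ → Allₚ.++⁺ }
    ; minimum = λ _ → [] }

  ≺L-ideal : ∀ A → IsRoundedIdeal _≤L_ _≺L_ (_≺L A)
  ≺L-ideal A = lowerᴸ-trans ≤-≺-trans
             , ([] , [])
             , (λ {B} {C} B≺A C≺A → B ++ C , Allₚ.++⁺ B≺A C≺A
                                  , ⊆⇒≤L (xs⊆xs++ys B C) , ⊆⇒≤L (xs⊆ys++xs C B))
             , λ _ → mk⇔ ≺L-interpolate (λ (_ , B≺C , C≺A) → ≺L-trans B≺C C≺A)

  ≺L-upper : ∀ A → IsRoundedUpper _≤L_ _≺L_ (A ≺L_)
  ≺L-upper A = (λ B≤C A≺B → lowerᴸ-trans ≺-≤-trans A≺B B≤C)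
             , λ _ → mk⇔ (λ A≺B → let (C , A≺C , C≺B) = ≺L-interpolate A≺B in C , C≺B , A≺C)
                         (λ (_ , C≺B , A≺C) → ≺L-trans A≺C C≺B)

  isStrongL : IsStrong _≈L_ _≤L_ _≺L_ _∨L_ 0L
  isStrongL = (λ A A≺[] → All.map (λ ()) A≺[] , [])
            , λ A B C A≺B++C →
                let (A₁ , A₂ , A⊆ , A₁≺B , A₂≺C) = lowerᴸ-++-split A A≺B++C
                in A₁ , A₂ , ⊆⇒≤L A⊆ , A₁≺B , A₂≺C

  isStrongProximityJoinSemilatticeL : IsStrongProximityJoinSemilatticeL
  isStrongProximityJoinSemilatticeL =
    isBoundedJoinSemilatticeL , (λ A → ≺L-ideal A , ≺L-upper A) , isStrongL

  -- A ≺_L {a}: interpolate A ≺_L C ≺_L {a}, then bound C inside the directed ideal ↓a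
  εL-rounded : ∀ {A a} → εL A a → ∃ λ b → b ≺ a × εL A b
  εL-rounded {a = a} A≺a =
    let (C , A≺C , C≺a) = ≺L-interpolate A≺a
        (b , b≺a , C≤b) = ideal-upperBound trans (≺-ideal a) (lowerᴸ-singletonʳ⁻ C≺a)
    in b , b≺a , lowerᴸ-trans ≺-≤-trans A≺C (lowerᴸ-singletonʳ⁺ C≤b)

  εL-approximable : IsApproximable _≤L_ _≺L_ _≤_ _≺_ εL
  εL-approximable =
      (λ a → ≺L-ideal [ a ])
    , λ A → (λ a≤b A≺a → lowerᴸ-trans ≺-≤-trans A≺a (lowerᴸ-singletonʳ⁺ (a≤b ∷ [])))
          , λ _ → mk⇔ εL-rounded
                      (λ (_ , b≺a , A≺b) → lowerᴸ-trans ≺-trans A≺b (lowerᴸ-singletonʳ⁺ (b≺a ∷ [])))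

  module UniversalProperty
    (S' : ProximityJoinSemilattice ℓ) (S'-strong : ProximityJoinSemilattice.IsStrongPJS S')
    (r : REL (ProximityJoinSemilattice.Carrier S') Carrier ℓ)
    (r-approximable : IsApproximable (ProximityJoinSemilattice._≤_ S')
                                     (ProximityJoinSemilattice._≺_ S') _≤_ _≺_ r)
    where
    open ProximityJoinSemilattice S' using (semilattice)
      renaming (Carrier to C'; _≤_ to _≤'_; _≺_ to _≺'_; ⊥ to ⊥'; isProximity to prox';
                refl to refl'; trans to trans'; antisym to antisym'; minimum to minimum';
                x≤x∨y to x≤x∨'y)
    open FiniteJoins semilattice
    open Approximable r-approximable
    open Proximity prox' using () renaming (≤-≺-trans to ≤'-≺'-trans; ≺-≤-trans to ≺'-≤'-trans)

    r̄ : REL C' FinS ℓ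
    r̄ x A = ∃ λ Y → x ≤' ⋁ Y × lowerᴸ r Y A

    ≺'-split-⋁ : ∀ {x} Y → x ≺' ⋁ Y → ∃ λ Z → x ≤' ⋁ Z × lowerᴸ _≺'_ Z Y
    ≺'-split-⋁ = split-⋁ (proj₁ S'-strong) (proj₂ S'-strong)

    r̄-ideal : ∀ A → IsRoundedIdeal _≤'_ _≺'_ (λ x → r̄ x A)
    r̄-ideal A =
        (λ x≤x' (Y , x'≤⋁Y , YrA) → Y , trans' x≤x' x'≤⋁Y , YrA)
      , (⊥' , [] , refl' , [])
      , (λ (Y₁ , x₁≤⋁Y₁ , Y₁rA) (Y₂ , x₂≤⋁Y₂ , Y₂rA) →
           ⋁ (Y₁ ++ Y₂) , (Y₁ ++ Y₂ , refl' , Allₚ.++⁺ Y₁rA Y₂rA)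
         , trans' x₁≤⋁Y₁ (⋁-mono-⊆ (xs⊆xs++ys Y₁ Y₂))
         , trans' x₂≤⋁Y₂ (⋁-mono-⊆ (xs⊆ys++xs Y₂ Y₁)))
      , λ x → mk⇔ (λ (Y , x≤⋁Y , YrA) →
                     let (Y' , Y≺Y' , Y'rA) = lowerᴸ-interpolate r-interpolateˡ YrA
                     in ⋁ Y' , ≤'-≺'-trans x≤⋁Y (⋁-≺ prox' Y≺Y') , (Y' , refl' , Y'rA))
                  (λ (_ , x≺x' , (Y , x'≤⋁Y , YrA)) →
                     let (Z , x≤⋁Z , Z≺Y) = ≺'-split-⋁ Y (≺'-≤'-trans x≺x' x'≤⋁Y)
                     in Z , x≤⋁Z , lowerᴸ-trans ≺-r-trans Z≺Y YrA)

    r̄-upper : ∀ x → IsRoundedUpper _≤L_ _≺L_ (r̄ x)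
    r̄-upper x =
        (λ A≤B (Y , x≤⋁Y , YrA) → Y , x≤⋁Y , lowerᴸ-trans r-≤-trans YrA A≤B)
      , λ A → mk⇔ (λ (Y , x≤⋁Y , YrA) →
                     let (B , YrB , B≺A) = lowerᴸ-interpolate r-interpolateʳ YrA
                     in B , B≺A , (Y , x≤⋁Y , YrB))
                  (λ (_ , B≺A , (Y , x≤⋁Y , YrB)) → Y , x≤⋁Y , lowerᴸ-trans r-≺-trans YrB B≺A)

    r̄-joinApproximable : IsJoinApproxIntoPL S' r̄
    r̄-joinApproximable =
        (r̄-ideal , r̄-upper)
      , (λ x (Y , x≤⋁Y , Yr[]) → antisym' (trans' x≤⋁Y (⋁-least (All.map (λ ()) Yr[]))) (minimum' x))
      , λ x B C (Y , x≤⋁Y , YrB++C) →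
          let (Y₁ , Y₂ , Y⊆ , Y₁rB , Y₂rC) = lowerᴸ-++-split Y YrB++C
          in ⋁ Y₁ , ⋁ Y₂ , trans' x≤⋁Y (trans' (⋁-mono-⊆ Y⊆) (⋁-++ Y₁ Y₂))
           , (Y₁ , refl' , Y₁rB) , (Y₂ , refl' , Y₂rC)

    εL∘r̄≐r : (εL ∘ᴿ r̄) ≐ᴿ r
    εL∘r̄≐r x a = mk⇔
      (λ (A , (Y , x≤⋁Y , YrA) , A≺a) →
         ≤-r-trans x≤⋁Y (ideal-⋁-closed (ideal a) (lowerᴸ-singletonʳ⁻ (lowerᴸ-trans r-≺-trans YrA A≺a))))
      (λ rxa → let (b , rxb , b≺a) = r-interpolateʳ rxa
               in [ b ] , ([ x ] , x≤x∨'y x ⊥' , here rxb ∷ []) , here b≺a ∷ [])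

    r̄-unique : (s : REL C' FinS ℓ) → IsJoinApproxIntoPL S' s → (εL ∘ᴿ s) ≐ᴿ r → s ≐ᴿ r̄
    r̄-unique s (s-approximable , s-zero , s-join) εL∘s≐r x A = mk⇔ s⇒r̄ r̄⇒s
      where
      module s = Approximable s-approximable

      s-then-≺⇒r : Trans (λ y c → s y [ c ]) _≺_ r
      s-then-≺⇒r s[c] c≺a = Equivalence.to (εL∘s≐r _ _) (_ , s[c] , here c≺a ∷ [])

      -- C is the join of its singletons, so s x C splits along the points of C
      s⇒r̄ : s x A → r̄ x A
      s⇒r̄ sxA =
        let (C , sxC , C≺A) = s.r-interpolateʳ sxA
            (Y , x≤⋁Y , Ys[C]) = split-⋁ s-zero s-join (map [_] C)
                                   (≡.subst (s x) (≡.sym (concat-map-[_] C)) sxC)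
        in Y , x≤⋁Y , lowerᴸ-trans s-then-≺⇒r (All.map Anyₚ.map⁻ Ys[C]) C≺A

      r⇒s : ∀ {y} → Any (r y) A → s y A
      r⇒s ryA =
        let (a , a∈A , rya) = find ryA
            (B , syB , B≺a) = Equivalence.from (εL∘s≐r _ a) rya
        in s.r-≤-trans (s.r-≺-trans syB B≺a) (lose a∈A refl ∷ [])

      r̄⇒s : r̄ x A → s x A
      r̄⇒s (Y , x≤⋁Y , YrA) = s.≤-r-trans x≤⋁Y (ideal-⋁-closed (s.ideal A) (All.map r⇒s YrA))

    uniqueLift : UniqueLift S' r
    uniqueLift = r̄ , r̄-joinApproximable , εL∘r̄≐r , r̄-unique

proposition3p23 : {ℓ : Level} (S : ProximityPoset ℓ) →
    LowerPowerlocale.IsStrongProximityJoinSemilatticeL S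
    × ( IsApproximable (LowerPowerlocale._≤L_ S) (LowerPowerlocale._≺L_ S)
          (ProximityPoset._≤_ S) (ProximityPoset._≺_ S) (LowerPowerlocale.εL S)
      × LowerPowerlocale.UniversalPropertyL S )
proposition3p23 S =
    isStrongProximityJoinSemilatticeL
  , εL-approximable
  , λ S' S'-strong r r-approximable → UniversalProperty.uniqueLift S' S'-strong r r-approximable
  where open LowerPowerlocaleProperties S
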